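{- For each integer $k\geq 0$, let $f_k(x)\in\mathbb{Q}[x]$ be the monic polynomial of degree $k+1$ such that for all integers $g>3k$, \[ \#\{S\in\mathcal{S}_g\mid m(S)=g-k\}=\frac{1}{(k+1)!}f_k(g). \] Then $f_k(x)$ has integer coefficients.
   Context: A numerical semigroup $S$ is a submonoid of $\mathbb{N}_0$ with finite complement; its genus is $|\mathbb{N}_0\setminus S|$ and its multiplicity $m(S)$ is its smallest nonzero element. $\mathcal{S}_g$ is the finite set of numerical semigroups of genus $g$. It is a known result (Kaplan) that for each $k\ge 0$ a monic polynomial $f_k\in\mathbb{Q}[x]$ of degree $k+1$ with the stated property exists; it is uniquely determined since it is prescribed at infinitely many points. -}

module Defs where

open import Data.Nat using (ℕ; zero; suc; _+_; _*_; _≤_; _<_)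
open import Data.Bool using (Bool; true; false)
open import Data.Integer using (ℤ; +_)
open import Data.Rational using (ℚ; _/_; 1ℚ; 0ℚ) renaming (_+_ to _+ℚ_; _*_ to _*ℚ_)
open import Data.List using (List; length)
open import Data.List.Relation.Unary.All using (All)
open import Data.List.Relation.Unary.Any using (Any)
open import Data.List.Relation.Unary.AllPairs using (AllPairs)
open import Data.Vec using (Vec; foldr; last; lookup)
open import Data.Fin using (Fin)
open import Data.Product using (Σ; _×_; ∃)
open import Relation.Nullary using (¬_)
open import Relation.Binary.PropositionalEquality using (_≡_; _≗_)

Subset : Set
Subset = ℕ → Bool

IsNumericalSemigroup : Subset → Set
IsNumericalSemigroup S =
  (S 0 ≡ true)
  × (∀ a b → S a ≡ true → S b ≡ true → S (a + b) ≡ true)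
  × (∃ λ N → ∀ n → N ≤ n → S n ≡ true)

HasSize : {A : Set} → (A → A → Set) → (A → Set) → ℕ → Set
HasSize {A} _≈_ P n =
  Σ (List A) λ L →
    (length L ≡ n)
    × All P L
    × AllPairs (λ x y → ¬ (x ≈ y)) L
    × (∀ x → P x → Any (x ≈_) L)

Gap : Subset → ℕ → Set
Gap S n = S n ≡ false

HasGenus : Subset → ℕ → Set
HasGenus S g = HasSize _≡_ (Gap S) g

HasMultiplicity : Subset → ℕ → Set
HasMultiplicity S m =
  (0 < m) × (S m ≡ true) × (∀ j → 0 < j → j < m → S j ≡ false)

InSgWithMult : ℕ → ℕ → Subset → Set
InSgWithMult g m S = IsNumericalSemigroup S × HasGenus S g × HasMultiplicity S m

-- #{S ∈ 𝒮_g | m(S) = m} = c  (numerical semigroups identified extensionally)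
CountSgMult : ℕ → ℕ → ℕ → Set
CountSgMult g m c = HasSize _≗_ (InSgWithMult g m) c

ℕtoℚ : ℕ → ℚ
ℕtoℚ n = (+ n) / 1

-- Polynomial of degree ≤ d with coefficients c₀, …, c_d (constant term first).
Poly : ℕ → Set
Poly d = Vec ℚ (suc d)

eval : ∀ {d} → Poly d → ℚ → ℚ
eval p x = foldr _ (λ c acc → c +ℚ (x *ℚ acc)) 0ℚ p

Monic : ∀ {d} → Poly d → Set
Monic p = last p ≡ 1ℚ

IsInteger : ℚ → Set
IsInteger q = ∃ λ (z : ℤ) → q ≡ z / 1

HasIntegerCoefficients : ∀ {d} → Poly d → Set
HasIntegerCoefficients {d} p = ∀ (i : Fin (suc d)) → IsInteger (lookup p i)

-- A polynomial p of degree ≤ d whose values at all large integers lie in d! ℤ has integer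
-- coefficients.  Its d-th forward difference is the constant d! · a, a the top coefficient,
-- and is an integer combination of values, so a ∈ ℤ.  The falling factorial
-- x (x - 1) ⋯ (x - d + 1) is monic with integer coefficients and takes values in d! ℤ, so
-- p - a · (falling factorial) has degree ≤ d - 1 and values in d! ℤ ⊆ (d - 1)! ℤ; induct on d.
-- The hypothesis of the theorem says exactly that f_k takes values in (k + 1)! ℤ for g > 3k.
module Submission where

open import Defs
open import Data.Nat using (ℕ; suc; _*_; _<_; _∸_; _!)
open import Data.Product using (∃; _×_)
open import Relation.Binary.PropositionalEquality using (_≡_)

open import Data.Nat as ℕ using (zero; _≤_; NonZero)
import Data.Nat.Properties as ℕ
open import Data.Nat.Divisibility using (_∣_; divides; _∣0)
open import Data.Nat.Combinatorics.Base using (_P′_)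
open import Data.Nat.Combinatorics.Specification using (k!∣nP′k)
open import Data.Nat.Coprimality using (1-coprimeTo)
import Data.Nat.Coprimality as Coprime
open import Data.Integer as ℤ using (ℤ; +_; -[1+_])
import Data.Integer.Properties as ℤ
open import Data.Rational as ℚ using (ℚ; mkℚ; 0ℚ; 1ℚ; 1/_)
import Data.Rational.Properties as ℚ
open import Data.Rational.Solver using (module +-*-Solver)
open import Data.Vec using (Vec; []; _∷_; _∷ʳ_; init; last; initLast; zipWith)
open import Data.Vec.Properties using (init-∷ʳ; last-∷ʳ)
open import Data.Vec.Relation.Unary.All as All using (All; []; _∷_)
open import Data.Vec.Relation.Unary.All.Properties using (lookup⁺)
open import Data.Product using (_,_; proj₂)
open import Data.Sum using (_⊎_; inj₁; inj₂)
open import Function using (_∘_)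
open import Relation.Binary.PropositionalEquality
  using (refl; sym; trans; cong; cong₂; subst; _≗_; module ≡-Reasoning)

open +-*-Solver

ℤtoℚ : ℤ → ℚ
ℤtoℚ z = z ℚ./ 1

ℤtoℚ-normal : ∀ z → ℤtoℚ z ≡ mkℚ z 0 (Coprime.sym (1-coprimeTo ℤ.∣ z ∣))
ℤtoℚ-normal (+ n)    = ℚ.normalize-coprime (Coprime.sym (1-coprimeTo n))
ℤtoℚ-normal -[1+ n ] = cong ℚ.-_ (ℚ.normalize-coprime (Coprime.sym (1-coprimeTo (suc n))))

ℤtoℚ-homo-+ : ∀ a b → ℤtoℚ (a ℤ.+ b) ≡ ℤtoℚ a ℚ.+ ℤtoℚ b
ℤtoℚ-homo-+ a b rewrite ℤtoℚ-normal a | ℤtoℚ-normal b =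
  cong (ℚ._/ 1) (cong₂ ℤ._+_ (sym (ℤ.*-identityʳ a)) (sym (ℤ.*-identityʳ b)))

ℤtoℚ-homo-* : ∀ a b → ℤtoℚ (a ℤ.* b) ≡ ℤtoℚ a ℚ.* ℤtoℚ b
ℤtoℚ-homo-* a b rewrite ℤtoℚ-normal a | ℤtoℚ-normal b = refl

ℤtoℚ-homo‿- : ∀ a → ℤtoℚ (ℤ.- a) ≡ ℚ.- ℤtoℚ a
ℤtoℚ-homo‿- (+ zero)  = refl
ℤtoℚ-homo‿- (+ suc n) = refl
ℤtoℚ-homo‿- -[1+ n ] rewrite ℤtoℚ-normal (+ suc n) = refl

ℤtoℚ-homo-- : ∀ a b → ℤtoℚ (a ℤ.- b) ≡ ℤtoℚ a ℚ.- ℤtoℚ b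
ℤtoℚ-homo-- a b = trans (ℤtoℚ-homo-+ a (ℤ.- b)) (cong (ℤtoℚ a ℚ.+_) (ℤtoℚ-homo‿- b))

ℕtoℚ-homo-* : ∀ m n → ℕtoℚ (m * n) ≡ ℕtoℚ m ℚ.* ℕtoℚ n
ℕtoℚ-homo-* m n = trans (cong ℤtoℚ (ℤ.pos-* m n)) (ℤtoℚ-homo-* (+ m) (+ n))

ℕtoℚ-suc : ∀ n → ℕtoℚ (suc n) ≡ ℕtoℚ n ℚ.+ 1ℚ
ℕtoℚ-suc n = trans (cong (ℤtoℚ ∘ +_) (ℕ.+-comm 1 n))
                   (trans (cong ℤtoℚ (sym (ℤ.pos-+ n 1))) (ℤtoℚ-homo-+ (+ n) (+ 1)))

ℕtoℚ-∸ : ∀ {m n} → n ≤ m → ℕtoℚ (m ∸ n) ≡ ℕtoℚ m ℚ.- ℕtoℚ n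
ℕtoℚ-∸ {m} {n} n≤m = begin
  ℤtoℚ (+ (m ∸ n))              ≡⟨ cong ℤtoℚ (sym (ℤ.⊖-≥ n≤m)) ⟩
  ℤtoℚ (m ℤ.⊖ n)                ≡⟨ cong ℤtoℚ (sym (ℤ.m-n≡m⊖n m n)) ⟩
  ℤtoℚ (+ m ℤ.- + n)            ≡⟨ ℤtoℚ-homo-- (+ m) (+ n) ⟩
  ℕtoℚ m ℚ.- ℕtoℚ n             ∎
  where open ≡-Reasoning

ℕtoℚ-cancelˡ : ∀ n .{{_ : NonZero n}} {a b} → ℕtoℚ n ℚ.* a ≡ ℕtoℚ n ℚ.* b → a ≡ b
ℕtoℚ-cancelˡ (suc m) {a} {b} eq rewrite ℤtoℚ-normal (+ suc m) = begin
  a                   ≡⟨ sym (1/n*[n*x]≡x a) ⟩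
  1/ n ℚ.* (n ℚ.* a)  ≡⟨ cong (1/ n ℚ.*_) eq ⟩
  1/ n ℚ.* (n ℚ.* b)  ≡⟨ 1/n*[n*x]≡x b ⟩
  b                   ∎
  where
  open ≡-Reasoning
  n : ℚ
  n = mkℚ (+ suc m) 0 _
  1/n*[n*x]≡x : ∀ x → 1/ n ℚ.* (n ℚ.* x) ≡ x
  1/n*[n*x]≡x x = trans (sym (ℚ.*-assoc (1/ n) n x))
                        (trans (cong (ℚ._* x) (ℚ.*-inverseˡ n)) (ℚ.*-identityˡ x))

IsInteger-+ : ∀ {a b} → IsInteger a → IsInteger b → IsInteger (a ℚ.+ b)
IsInteger-+ (x , refl) (y , refl) = x ℤ.+ y , sym (ℤtoℚ-homo-+ x y)

IsInteger-- : ∀ {a b} → IsInteger a → IsInteger b → IsInteger (a ℚ.- b)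
IsInteger-- (x , refl) (y , refl) = x ℤ.- y , sym (ℤtoℚ-homo-- x y)

IsInteger-* : ∀ {a b} → IsInteger a → IsInteger b → IsInteger (a ℚ.* b)
IsInteger-* (x , refl) (y , refl) = x ℤ.* y , sym (ℤtoℚ-homo-* x y)

infix 4 _∣ℚ_

record _∣ℚ_ (m q : ℚ) : Set where
  constructor dividesℚ
  field
    quotient : ℤ
    equality : q ≡ m ℚ.* ℤtoℚ quotient

∣ℚ-- : ∀ {m a b} → m ∣ℚ a → m ∣ℚ b → m ∣ℚ a ℚ.- b
∣ℚ-- {m} (dividesℚ x refl) (dividesℚ y refl) = dividesℚ (x ℤ.- y) (begin
  m ℚ.* ℤtoℚ x ℚ.- m ℚ.* ℤtoℚ y
    ≡⟨ solve 3 (λ m x y → m :* x :- m :* y := m :* (x :- y)) refl m (ℤtoℚ x) (ℤtoℚ y) ⟩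
  m ℚ.* (ℤtoℚ x ℚ.- ℤtoℚ y)
    ≡⟨ cong (m ℚ.*_) (ℤtoℚ-homo-- x y) ⟨
  m ℚ.* ℤtoℚ (x ℤ.- y)
    ∎)
  where open ≡-Reasoning

∣ℚ-*ˡ : ∀ {m a c} → IsInteger c → m ∣ℚ a → m ∣ℚ c ℚ.* a
∣ℚ-*ˡ {m} (x , refl) (dividesℚ y refl) = dividesℚ (x ℤ.* y) (begin
  ℤtoℚ x ℚ.* (m ℚ.* ℤtoℚ y)
    ≡⟨ solve 3 (λ m x y → x :* (m :* y) := m :* (x :* y)) refl m (ℤtoℚ x) (ℤtoℚ y) ⟩
  m ℚ.* (ℤtoℚ x ℚ.* ℤtoℚ y)
    ≡⟨ cong (m ℚ.*_) (ℤtoℚ-homo-* x y) ⟨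
  m ℚ.* ℤtoℚ (x ℤ.* y)
    ∎)
  where open ≡-Reasoning

m*n∣ℚq⇒n∣ℚq : ∀ m n {q} → ℕtoℚ (m * n) ∣ℚ q → ℕtoℚ n ∣ℚ q
m*n∣ℚq⇒n∣ℚq m n (dividesℚ z refl) = dividesℚ (+ m ℤ.* z) (begin
  ℕtoℚ (m * n) ℚ.* ℤtoℚ z
    ≡⟨ cong (ℚ._* ℤtoℚ z) (ℕtoℚ-homo-* m n) ⟩
  ℕtoℚ m ℚ.* ℕtoℚ n ℚ.* ℤtoℚ z
    ≡⟨ solve 3 (λ m n z → m :* n :* z := n :* (m :* z)) refl (ℕtoℚ m) (ℕtoℚ n) (ℤtoℚ z) ⟩
  ℕtoℚ n ℚ.* (ℕtoℚ m ℚ.* ℤtoℚ z)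
    ≡⟨ cong (ℕtoℚ n ℚ.*_) (ℤtoℚ-homo-* (+ m) z) ⟨
  ℕtoℚ n ℚ.* ℤtoℚ (+ m ℤ.* z)
    ∎)
  where open ≡-Reasoning

∣⇒∣ℚ : ∀ {m n} → m ∣ n → ℕtoℚ m ∣ℚ ℕtoℚ n
∣⇒∣ℚ {m} (divides q refl) = dividesℚ (+ q) (trans (ℕtoℚ-homo-* q m) (ℚ.*-comm (ℕtoℚ q) (ℕtoℚ m)))

n∣ℚn*a⇒IsInteger : ∀ n .{{_ : NonZero n}} {a} → ℕtoℚ n ∣ℚ ℕtoℚ n ℚ.* a → IsInteger a
n∣ℚn*a⇒IsInteger n (dividesℚ z eq) = z , ℕtoℚ-cancelˡ n eq

Δ : (ℕ → ℚ) → ℕ → ℚ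
Δ F g = F (suc g) ℚ.- F g

-- F agrees on ℕ with a polynomial of degree ≤ d whose coefficient of x^d is a:
-- constant a for d = 0, and otherwise Δ F has degree ≤ d - 1 with top coefficient d · a.
data PolyFun : ℕ → ℚ → (ℕ → ℚ) → Set where
  constant   : ∀ {a F} → (∀ g → F g ≡ a) → PolyFun zero a F
  difference : ∀ {d a F} → PolyFun d (ℕtoℚ (suc d) ℚ.* a) (Δ F) → PolyFun (suc d) a F

PolyFun-cong : ∀ {d a F G} → F ≗ G → PolyFun d a F → PolyFun d a G
PolyFun-cong F≗G (constant P)   = constant λ g → trans (sym (F≗G g)) (P g)
PolyFun-cong F≗G (difference P) = difference (PolyFun-cong (λ g → cong₂ ℚ._-_ (F≗G (suc g)) (F≗G g)) P)

PolyFun-+ : ∀ {d a b F G} → PolyFun d a F → PolyFun d b G → PolyFun d (a ℚ.+ b) (λ g → F g ℚ.+ G g)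
PolyFun-+ (constant PF) (constant PG) = constant λ g → cong₂ ℚ._+_ (PF g) (PG g)
PolyFun-+ {suc d} {a} {b} {F} {G} (difference PF) (difference PG) =
  difference (PolyFun-cong Δ-+ (subst (λ c → PolyFun d c _) distrib (PolyFun-+ PF PG)))
  where
  distrib : ℕtoℚ (suc d) ℚ.* a ℚ.+ ℕtoℚ (suc d) ℚ.* b ≡ ℕtoℚ (suc d) ℚ.* (a ℚ.+ b)
  distrib = sym (ℚ.*-distribˡ-+ (ℕtoℚ (suc d)) a b)
  Δ-+ : ∀ g → Δ F g ℚ.+ Δ G g ≡ Δ (λ h → F h ℚ.+ G h) g
  Δ-+ g = solve 4 (λ f₁ f₀ g₁ g₀ → (f₁ :- f₀) :+ (g₁ :- g₀) := (f₁ :+ g₁) :- (f₀ :+ g₀))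
                refl (F (suc g)) (F g) (G (suc g)) (G g)

PolyFun-shift : ∀ {d a F} → PolyFun d a F → PolyFun d a (F ∘ suc)
PolyFun-shift (constant P)   = constant (P ∘ suc)
PolyFun-shift (difference P) = difference (PolyFun-shift P)

PolyFun-const+ : ∀ {d a F} c → PolyFun (suc d) a F → PolyFun (suc d) a (λ g → c ℚ.+ F g)
PolyFun-const+ {F = F} c (difference P) = difference (PolyFun-cong (λ g →
  solve 3 (λ c f₁ f₀ → f₁ :- f₀ := (c :+ f₁) :- (c :+ f₀)) refl c (F (suc g)) (F g)) P)

Δ-ℕtoℚ* : ∀ F g → Δ (λ h → ℕtoℚ h ℚ.* F h) g ≡ F (suc g) ℚ.+ ℕtoℚ g ℚ.* Δ F g
Δ-ℕtoℚ* F g rewrite ℕtoℚ-suc g =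
  solve 3 (λ x f₁ f₀ → (x :+ con 1ℚ) :* f₁ :- x :* f₀ := f₁ :+ x :* (f₁ :- f₀))
          refl (ℕtoℚ g) (F (suc g)) (F g)

PolyFun-ℕtoℚ* : ∀ {d a F} → PolyFun d a F → PolyFun (suc d) a (λ g → ℕtoℚ g ℚ.* F g)
PolyFun-ℕtoℚ* {a = a} {F} (constant P) = difference (constant λ g → begin
  Δ (λ h → ℕtoℚ h ℚ.* F h) g
    ≡⟨ Δ-ℕtoℚ* F g ⟩
  F (suc g) ℚ.+ ℕtoℚ g ℚ.* Δ F g
    ≡⟨ cong₂ (λ u v → u ℚ.+ ℕtoℚ g ℚ.* (u ℚ.- v)) (P (suc g)) (P g) ⟩
  a ℚ.+ ℕtoℚ g ℚ.* (a ℚ.- a)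
    ≡⟨ solve 2 (λ a x → a :+ x :* (a :- a) := con 1ℚ :* a) refl a (ℕtoℚ g) ⟩
  1ℚ ℚ.* a
    ∎)
  where open ≡-Reasoning
PolyFun-ℕtoℚ* {suc d} {a} {F} P@(difference ΔP) =
  difference (PolyFun-cong (sym ∘ Δ-ℕtoℚ* F)
    (subst (λ c → PolyFun (suc d) c _) a+[1+d]a≡[2+d]a
      (PolyFun-+ (PolyFun-shift P) (PolyFun-ℕtoℚ* ΔP))))
  where
  a+[1+d]a≡[2+d]a : a ℚ.+ ℕtoℚ (suc d) ℚ.* a ≡ ℕtoℚ (suc (suc d)) ℚ.* a
  a+[1+d]a≡[2+d]a rewrite ℕtoℚ-suc (suc d) =
    solve 2 (λ a n → a :+ n :* a := (n :+ con 1ℚ) :* a) refl a (ℕtoℚ (suc d))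

PolyFun-eval : ∀ {d} (p : Poly d) → PolyFun d (last p) (λ g → eval p (ℕtoℚ g))
PolyFun-eval (c ∷ [])        =
  constant λ g → trans (cong (c ℚ.+_) (ℚ.*-zeroʳ (ℕtoℚ g))) (ℚ.+-identityʳ c)
PolyFun-eval (c ∷ p@(_ ∷ _)) = PolyFun-const+ c (PolyFun-ℕtoℚ* (PolyFun-eval p))

PolyFun-∣ℚ-lead : ∀ {d a F} N {m} → PolyFun d a F → (∀ g → N ≤ g → m ∣ℚ F g) →
                  m ∣ℚ ℕtoℚ (d !) ℚ.* a
PolyFun-∣ℚ-lead {a = a} N {m} (constant P) m∣F =
  subst (m ∣ℚ_) (trans (P N) (sym (ℚ.*-identityˡ a))) (m∣F N ℕ.≤-refl)
PolyFun-∣ℚ-lead {suc d} {a} {F} N {m} (difference P) m∣F =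
  subst (m ∣ℚ_) d![[1+d]a]≡[1+d]!a (PolyFun-∣ℚ-lead N P m∣ΔF)
  where
  m∣ΔF : ∀ g → N ≤ g → m ∣ℚ Δ F g
  m∣ΔF g N≤g = ∣ℚ-- (m∣F (suc g) (ℕ.m≤n⇒m≤1+n N≤g)) (m∣F g N≤g)
  d![[1+d]a]≡[1+d]!a : ℕtoℚ (d !) ℚ.* (ℕtoℚ (suc d) ℚ.* a) ≡ ℕtoℚ ((suc d) !) ℚ.* a
  d![[1+d]a]≡[1+d]!a rewrite ℕtoℚ-homo-* (suc d) (d !) =
    solve 3 (λ f n a → f :* (n :* a) := n :* f :* a) refl (ℕtoℚ (d !)) (ℕtoℚ (suc d)) a

infixl 6 _⊖[_]_

_⊖[_]_ : ∀ {n} → Vec ℚ n → ℚ → Vec ℚ n → Vec ℚ n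
p ⊖[ a ] q = zipWith (λ u v → u ℚ.- a ℚ.* v) p q

eval-⊖ : ∀ {d} (p q : Poly d) a x → eval (p ⊖[ a ] q) x ≡ eval p x ℚ.- a ℚ.* eval q x
eval-⊖ (u ∷ []) (v ∷ []) a x =
  solve 4 (λ u v a x → (u :- a :* v) :+ x :* con 0ℚ := (u :+ x :* con 0ℚ) :- a :* (v :+ x :* con 0ℚ))
        refl u v a x
eval-⊖ (u ∷ p@(_ ∷ _)) (v ∷ q@(_ ∷ _)) a x = begin
  (u ℚ.- a ℚ.* v) ℚ.+ x ℚ.* eval (p ⊖[ a ] q) x
    ≡⟨ cong (λ e → (u ℚ.- a ℚ.* v) ℚ.+ x ℚ.* e) (eval-⊖ p q a x) ⟩
  (u ℚ.- a ℚ.* v) ℚ.+ x ℚ.* (eval p x ℚ.- a ℚ.* eval q x)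
    ≡⟨ solve 6 (λ u v a x P Q → (u :- a :* v) :+ x :* (P :- a :* Q) := (u :+ x :* P) :- a :* (v :+ x :* Q))
               refl u v a x (eval p x) (eval q x) ⟩
  (u ℚ.+ x ℚ.* eval p x) ℚ.- a ℚ.* (v ℚ.+ x ℚ.* eval q x)
    ∎
  where open ≡-Reasoning

last-⊖ : ∀ {n} (p q : Vec ℚ (suc n)) a → last (p ⊖[ a ] q) ≡ last p ℚ.- a ℚ.* last q
last-⊖ (u ∷ [])        (v ∷ [])        a = refl
last-⊖ (u ∷ p@(_ ∷ _)) (v ∷ q@(_ ∷ _)) a = last-⊖ p q a

eval-init : ∀ {d} (p : Poly (suc d)) x → last p ≡ 0ℚ → eval (init p) x ≡ eval p x
eval-init (u ∷ v ∷ []) x refl =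
  solve 2 (λ u x → u :+ x :* con 0ℚ := u :+ x :* (con 0ℚ :+ x :* con 0ℚ)) refl u x
eval-init (u ∷ p@(_ ∷ _ ∷ _)) x last≡0 = cong (λ e → u ℚ.+ x ℚ.* e) (eval-init p x last≡0)

∷ʳ⁺ : ∀ {P : ℚ → Set} {n} {xs : Vec ℚ n} {x} → All P xs → P x → All P (xs ∷ʳ x)
∷ʳ⁺ []         px = px ∷ []
∷ʳ⁺ (py ∷ pys) px = py ∷ ∷ʳ⁺ pys px

init-last⁺ : ∀ {P : ℚ → Set} {n} (xs : Vec ℚ (suc n)) → All P (init xs) → P (last xs) → All P xs
init-last⁺ {P} xs pinit plast = subst (All P) (sym (proj₂ (proj₂ (initLast xs)))) (∷ʳ⁺ pinit plast)

⊖-IsInteger⁻ : ∀ {n a} {p q : Vec ℚ n} → IsInteger a → All IsInteger q →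
               All IsInteger (p ⊖[ a ] q) → All IsInteger p
⊖-IsInteger⁻ {p = []}    {[]}    ia []         []           = []
⊖-IsInteger⁻ {a = a} {u ∷ p} {v ∷ q} ia (iv ∷ iq) (iw ∷ iws) =
  subst IsInteger (solve 3 (λ u a v → (u :- a :* v) :+ a :* v := u) refl u a v)
                  (IsInteger-+ iw (IsInteger-* ia iv))
  ∷ ⊖-IsInteger⁻ ia iq iws

[X-_]*_ : ∀ {d} → ℚ → Poly d → Poly (suc d)
[X- r ]* p = (0ℚ ∷ p) ⊖[ r ] (p ∷ʳ 0ℚ)

eval-∷ʳ0 : ∀ {d} (p : Poly d) x → eval (p ∷ʳ 0ℚ) x ≡ eval p x
eval-∷ʳ0 p x = trans (sym (eval-init (p ∷ʳ 0ℚ) x (last-∷ʳ 0ℚ p))) (cong (λ q → eval q x) (init-∷ʳ 0ℚ p))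

eval-[X-]* : ∀ {d} r (p : Poly d) x → eval ([X- r ]* p) x ≡ (x ℚ.- r) ℚ.* eval p x
eval-[X-]* r p x = begin
  eval ([X- r ]* p) x
    ≡⟨ eval-⊖ (0ℚ ∷ p) (p ∷ʳ 0ℚ) r x ⟩
  0ℚ ℚ.+ x ℚ.* eval p x ℚ.- r ℚ.* eval (p ∷ʳ 0ℚ) x
    ≡⟨ cong (λ e → 0ℚ ℚ.+ x ℚ.* eval p x ℚ.- r ℚ.* e) (eval-∷ʳ0 p x) ⟩
  0ℚ ℚ.+ x ℚ.* eval p x ℚ.- r ℚ.* eval p x
    ≡⟨ solve 3 (λ x r e → con 0ℚ :+ x :* e :- r :* e := (x :- r) :* e) refl x r (eval p x) ⟩
  (x ℚ.- r) ℚ.* eval p x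
    ∎
  where open ≡-Reasoning

last-[X-]* : ∀ {d} r (p : Poly d) → last ([X- r ]* p) ≡ last p
last-[X-]* r p = begin
  last ([X- r ]* p)                    ≡⟨ last-⊖ (0ℚ ∷ p) (p ∷ʳ 0ℚ) r ⟩
  last p ℚ.- r ℚ.* last (p ∷ʳ 0ℚ)      ≡⟨ cong (λ e → last p ℚ.- r ℚ.* e) (last-∷ʳ 0ℚ p) ⟩
  last p ℚ.- r ℚ.* 0ℚ                  ≡⟨ solve 2 (λ l r → l :- r :* con 0ℚ := l) refl (last p) r ⟩
  last p                               ∎
  where open ≡-Reasoning

[X-]*-IsInteger : ∀ {d r} {p : Poly d} → IsInteger r → All IsInteger p → All IsInteger ([X- r ]* p)
[X-]*-IsInteger ir ip =
  All.zipWith (λ iu iv → IsInteger-- iu (IsInteger-* ir iv)) ((+ 0 , refl) ∷ ip) (∷ʳ⁺ ip (+ 0 , refl))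

falling : ∀ d → Poly d
falling zero    = 1ℚ ∷ []
falling (suc d) = [X- ℕtoℚ d ]* falling d

falling-monic : ∀ d → last (falling d) ≡ 1ℚ
falling-monic zero    = refl
falling-monic (suc d) = trans (last-[X-]* (ℕtoℚ d) (falling d)) (falling-monic d)

falling-IsInteger : ∀ d → All IsInteger (falling d)
falling-IsInteger zero    = (+ 1 , refl) ∷ []
falling-IsInteger (suc d) = [X-]*-IsInteger (+ d , refl) (falling-IsInteger d)

n≤k⇒nP′[1+k]≡0 : ∀ {n k} → n ≤ k → n P′ suc k ≡ 0
n≤k⇒nP′[1+k]≡0 {n} {k} n≤k rewrite ℕ.m≤n⇒m∸n≡0 n≤k = refl

eval-falling : ∀ d g → eval (falling d) (ℕtoℚ g) ≡ ℕtoℚ (g P′ d)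
eval-falling zero    g = trans (cong (1ℚ ℚ.+_) (ℚ.*-zeroʳ (ℕtoℚ g))) (ℚ.+-identityʳ 1ℚ)
eval-falling (suc d) g = begin
  eval (falling (suc d)) (ℕtoℚ g)                     ≡⟨ eval-[X-]* (ℕtoℚ d) (falling d) (ℕtoℚ g) ⟩
  (ℕtoℚ g ℚ.- ℕtoℚ d) ℚ.* eval (falling d) (ℕtoℚ g)   ≡⟨ cong ((ℕtoℚ g ℚ.- ℕtoℚ d) ℚ.*_) (eval-falling d g) ⟩
  (ℕtoℚ g ℚ.- ℕtoℚ d) ℚ.* ℕtoℚ (g P′ d)               ≡⟨ truncate (ℕ.≤-<-connex d g) ⟩
  ℕtoℚ (g ∸ d) ℚ.* ℕtoℚ (g P′ d)                      ≡⟨ ℕtoℚ-homo-* (g ∸ d) (g P′ d) ⟨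
  ℕtoℚ (g P′ suc d)                                   ∎
  where
  open ≡-Reasoning
  -- For g < d the difference g - d is negative, but then g P′ d = 0.
  truncate : d ≤ g ⊎ g < d → (ℕtoℚ g ℚ.- ℕtoℚ d) ℚ.* ℕtoℚ (g P′ d) ≡ ℕtoℚ (g ∸ d) ℚ.* ℕtoℚ (g P′ d)
  truncate (inj₁ d≤g) = cong (ℚ._* ℕtoℚ (g P′ d)) (sym (ℕtoℚ-∸ d≤g))
  truncate (inj₂ (ℕ.s≤s g≤d-1)) rewrite n≤k⇒nP′[1+k]≡0 g≤d-1 =
    trans (ℚ.*-zeroʳ (ℕtoℚ g ℚ.- ℕtoℚ d)) (sym (ℚ.*-zeroʳ (ℕtoℚ (g ∸ d))))

d!∣ℚfalling : ∀ d g → ℕtoℚ (d !) ∣ℚ eval (falling d) (ℕtoℚ g)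
d!∣ℚfalling d g = subst (ℕtoℚ (d !) ∣ℚ_) (sym (eval-falling d g)) (∣⇒∣ℚ (d!∣gP′d (ℕ.≤-<-connex d g)))
  where
  d!∣gP′d : d ≤ g ⊎ g < d → d ! ∣ g P′ d
  d!∣gP′d (inj₁ d≤g)              = k!∣nP′k d≤g
  d!∣gP′d (inj₂ (ℕ.s≤s g≤d-1)) rewrite n≤k⇒nP′[1+k]≡0 g≤d-1 = (d !) ∣0

lead-IsInteger : ∀ d (p : Poly d) N → (∀ g → N ≤ g → ℕtoℚ (d !) ∣ℚ eval p (ℕtoℚ g)) →
                 IsInteger (last p)
lead-IsInteger d p N d!∣p =
  n∣ℚn*a⇒IsInteger (d !) {{d ℕ.!≢0}} (PolyFun-∣ℚ-lead N (PolyFun-eval p) d!∣p)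

d!∣ℚeval⇒All-IsInteger : ∀ d (p : Poly d) N → (∀ g → N ≤ g → ℕtoℚ (d !) ∣ℚ eval p (ℕtoℚ g)) →
                         All IsInteger p
d!∣ℚeval⇒All-IsInteger zero (c ∷ []) N d!∣p = lead-IsInteger zero (c ∷ []) N d!∣p ∷ []
d!∣ℚeval⇒All-IsInteger (suc d) p N d!∣p =
  ⊖-IsInteger⁻ ia (falling-IsInteger (suc d))
    (init-last⁺ w (d!∣ℚeval⇒All-IsInteger d (init w) N d!∣init-w)
                  (subst IsInteger (sym last-w≡0) (+ 0 , refl)))
  where
  a : ℚ
  a = last p
  ia : IsInteger a
  ia = lead-IsInteger (suc d) p N d!∣p
  w : Poly (suc d)
  w = p ⊖[ a ] falling (suc d)
  last-w≡0 : last w ≡ 0ℚ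
  last-w≡0 = begin
    last w                                     ≡⟨ last-⊖ p (falling (suc d)) a ⟩
    a ℚ.- a ℚ.* last (falling (suc d))         ≡⟨ cong (λ l → a ℚ.- a ℚ.* l) (falling-monic (suc d)) ⟩
    a ℚ.- a ℚ.* 1ℚ                             ≡⟨ solve 1 (λ a → a :- a :* con 1ℚ := con 0ℚ) refl a ⟩
    0ℚ                                         ∎
    where open ≡-Reasoning
  eval-init-w : ∀ x → eval (init w) x ≡ eval p x ℚ.- a ℚ.* eval (falling (suc d)) x
  eval-init-w x = trans (eval-init w x last-w≡0) (eval-⊖ p (falling (suc d)) a x)
  d!∣init-w : ∀ g → N ≤ g → ℕtoℚ (d !) ∣ℚ eval (init w) (ℕtoℚ g)
  d!∣init-w g N≤g = m*n∣ℚq⇒n∣ℚq (suc d) (d !) (subst (ℕtoℚ ((suc d) !) ∣ℚ_) (sym (eval-init-w (ℕtoℚ g)))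
    (∣ℚ-- (d!∣p g N≤g) (∣ℚ-*ˡ ia (d!∣ℚfalling (suc d) g))))

corollary1p13 : ∀ (k : ℕ) (f : Poly (suc k)) → Monic f
    → (∀ (g : ℕ) → 3 * k < g
         → ∃ λ (c : ℕ) → CountSgMult g (g ∸ k) c
                          × eval f (ℕtoℚ g) ≡ ℕtoℚ (((suc k) !) * c))
    → HasIntegerCoefficients f
corollary1p13 k f _ count = lookup⁺ (d!∣ℚeval⇒All-IsInteger (suc k) f (suc (3 * k)) [1+k]!∣f)
  where
  [1+k]!∣f : ∀ g → suc (3 * k) ≤ g → ℕtoℚ ((suc k) !) ∣ℚ eval f (ℕtoℚ g)
  [1+k]!∣f g 3k<g with count g 3k<g
  ... | c , _ , f[g]≡[1+k]!c = dividesℚ (+ c) (trans f[g]≡[1+k]!c (ℕtoℚ-homo-* ((suc k) !) c))
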